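{- Let $n\geqslant 2$, $\mathbf{e}\in\mathbb{F}_2^n$, $\mathbf{a}\in\mathbb{F}_4^n$. Let $\tau$ be a group automorphism of $G_{\mathbf{e}}$ which is a generalized isometry of $Q_{\mathbf{a}}$ of order $e>1$, let $K$ be a $\tau$-invariant subgroup of $G_{\mathbf{e}}$ of index $e$, and let $h\in G_{\mathbf{e}}$ be such that $h_e\in K$ and $h_1,\dots,h_{e-1}\notin K$, where $h_i=h+\tau(h)+\cdots+\tau^{i-1}(h)$. If $[G_{\mathbf{e}}:\mathrm{Fix}(\tau)]>e$, where $\mathrm{Fix}(\tau)=\{g\in G_{\mathbf{e}}:\tau(g)=g\}$, then the group $G_{K,\tau,h}=\langle R(K),R(h)\tau\rangle$ is non-abelian.
   Context: $\mathbb{F}_4=\{0,1,\omega,\omega+1\}$. For $\epsilon\in\mathbb{F}_2$, $G_\epsilon$ is the abelian group on $\mathbb{F}_4\times\mathbb{F}_4$ with $(x,y)+(x',y')=(x+x',\,y+y'+\epsilon(xx')^2)$; $Q_\alpha(x,y)=\alpha x^2+xy+y^2$ for $\alpha\in\mathbb{F}_4$. For $\mathbf{e}=(\epsilon_i)\in\mathbb{F}_2^n$, $\mathbf{a}=(\alpha_i)\in\mathbb{F}_4^n$: $G_{\mathbf{e}}=\bigoplus_i G_{\epsilon_i}$ (additive) and $Q_{\mathbf{a}}((x_i,y_i)_i)=\sum_i Q_{\alpha_i}(x_i,y_i)$. A group automorphism $\tau$ of $G_{\mathbf{e}}$ is a generalized isometry of $Q_{\mathbf{a}}$ if for some $\sigma\in\mathrm{Gal}(\mathbb{F}_4/\mathbb{F}_2)$,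 $Q_{\mathbf{a}}(\tau(g))=\sigma(Q_{\mathbf{a}}(g))$ for all $g$. $R(g)$ denotes the translation $x\mapsto x+g$ of $G_{\mathbf{e}}$, $R(K)=\{R(g):g\in K\}$, and $G_{K,\tau,h}$ is the group of permutations of $G_{\mathbf{e}}$ generated by $R(K)$ and $R(h)\circ\tau$. -}

module Defs where

open import Data.Bool using (Bool; true; false; if_then_else_)
open import Data.Nat using (ℕ; zero; suc; _*_; _^_)
open import Data.Product using (_×_; _,_)
open import Data.Vec using (Vec; []; _∷_; replicate)
open import Data.List using (List; []; _∷_; length; filter; concatMap; map)
open import Relation.Binary.PropositionalEquality using (_≡_)
open import Relation.Unary using (Pred; Decidable)
open import Function using (id; _∘_)
open import Level using (0ℓ)

data F4 : Set where
  𝟎 𝟏 ω ω+1 : F4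

infixl 6 _⊕_
infixl 7 _⊗_

_⊕_ : F4 → F4 → F4
𝟎 ⊕ y = y
x ⊕ 𝟎 = x
𝟏 ⊕ 𝟏 = 𝟎
𝟏 ⊕ ω = ω+1
𝟏 ⊕ ω+1 = ω
ω ⊕ 𝟏 = ω+1
ω ⊕ ω = 𝟎
ω ⊕ ω+1 = 𝟏
ω+1 ⊕ 𝟏 = ω
ω+1 ⊕ ω = 𝟏
ω+1 ⊕ ω+1 = 𝟎

_⊗_ : F4 → F4 → F4
𝟎 ⊗ y = 𝟎
𝟏 ⊗ y = y
ω ⊗ 𝟎 = 𝟎
ω ⊗ 𝟏 = ω
ω ⊗ ω = ω+1
ω ⊗ ω+1 = 𝟏
ω+1 ⊗ 𝟎 = 𝟎
ω+1 ⊗ 𝟏 = ω+1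
ω+1 ⊗ ω = 𝟏
ω+1 ⊗ ω+1 = ω

sq : F4 → F4
sq x = x ⊗ x

allF4 : List F4
allF4 = 𝟎 ∷ 𝟏 ∷ ω ∷ ω+1 ∷ []

-- F2 is represented by Bool (false = 0, true = 1); its image in F4:
ι : Bool → F4
ι false = 𝟎
ι true = 𝟏

-- Gal(F4/F2) = {id, Frobenius x ↦ x²}, indexed by a Bool
galois : Bool → F4 → F4
galois false x = x
galois true x = sq x

G : ℕ → Set
G n = Vec (F4 × F4) n

addG : ∀ {n} → Vec Bool n → G n → G n → G n
addG [] [] [] = []
addG (ε ∷ es) ((x , y) ∷ g) ((x' , y') ∷ g') =
  (x ⊕ x' , y ⊕ y' ⊕ ι ε ⊗ sq (x ⊗ x')) ∷ addG es g g'

zeroG : ∀ {n} → G n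
zeroG {n} = replicate n (𝟎 , 𝟎)

negG : ∀ {n} → Vec Bool n → G n → G n
negG [] [] = []
negG (ε ∷ es) ((x , y) ∷ g) = (x , y ⊕ ι ε ⊗ sq (x ⊗ x)) ∷ negG es g

Q : ∀ {n} → Vec F4 n → G n → F4
Q [] [] = 𝟎
Q (α ∷ as) ((x , y) ∷ g) = (α ⊗ sq x ⊕ x ⊗ y ⊕ sq y) ⊕ Q as g

allG : (n : ℕ) → List (G n)
allG zero = [] ∷ []
allG (suc n) =
  concatMap (λ x → concatMap (λ y → map ((x , y) ∷_) (allG n)) allF4) allF4

card : ∀ {n} (P : Pred (G n) 0ℓ) → Decidable P → ℕ
card {n} P P? = length (filter P? (allG n))

iter : ∀ {A : Set} → (A → A) → ℕ → A → A
iter f zero = id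
iter f (suc k) = f ∘ iter f k

hsum : ∀ {n} → Vec Bool n → (G n → G n) → G n → ℕ → G n
hsum es τ h zero = zeroG
hsum es τ h (suc i) = addG es (hsum es τ h i) (iter τ i h)

R : ∀ {n} → Vec Bool n → G n → G n → G n
R es g x = addG es x g

-- Elements of the permutation group G_{K,τ,h} generated by R(K) and R(h)∘τ
-- (tinv is the inverse of τ; the inverse of R(h)∘τ is tinv ∘ R(-h),
--  and R(K) is closed under inverses since K is a subgroup).
data InGen {n} (es : Vec Bool n) (K : G n → Bool) (τ tinv : G n → G n) (h : G n)
     : (G n → G n) → Set where
  gen-id   : InGen es K τ tinv h id
  gen-R    : ∀ {f} (k : G n) → K k ≡ true → InGen es K τ tinv h f
           → InGen es K τ tinv h (R es k ∘ f)
  gen-Rτ   : ∀ {f} → InGen es K τ tinv h f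
           → InGen es K τ tinv h ((R es h ∘ τ) ∘ f)
  gen-Rτ⁻¹ : ∀ {f} → InGen es K τ tinv h f
           → InGen es K τ tinv h ((tinv ∘ R es (negG es h)) ∘ f)

open import Relation.Nullary using (Dec; yes; no)
open import Relation.Binary.PropositionalEquality using (refl)
open import Relation.Binary.Definitions using (DecidableEquality)
import Data.Vec.Properties as VP
import Data.Product.Properties as PP

_≟F4_ : DecidableEquality F4
𝟎 ≟F4 𝟎 = yes refl
𝟎 ≟F4 𝟏 = no λ ()
𝟎 ≟F4 ω = no λ ()
𝟎 ≟F4 ω+1 = no λ ()
𝟏 ≟F4 𝟎 = no λ ()
𝟏 ≟F4 𝟏 = yes refl
𝟏 ≟F4 ω = no λ ()
𝟏 ≟F4 ω+1 = no λ ()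
ω ≟F4 𝟎 = no λ ()
ω ≟F4 𝟏 = no λ ()
ω ≟F4 ω = yes refl
ω ≟F4 ω+1 = no λ ()
ω+1 ≟F4 𝟎 = no λ ()
ω+1 ≟F4 𝟏 = no λ ()
ω+1 ≟F4 ω = no λ ()
ω+1 ≟F4 ω+1 = yes refl

_≟G_ : ∀ {n} → DecidableEquality (G n)
_≟G_ = VP.≡-dec (PP.≡-dec _≟F4_ _≟F4_)

record IsSubgroup {n} (es : Vec Bool n) (K : G n → Bool) : Set where
  field
    has-zero : K zeroG ≡ true
    add-closed : ∀ g g' → K g ≡ true → K g' ≡ true → K (addG es g g') ≡ true
    neg-closed : ∀ g → K g ≡ true → K (negG es g) ≡ true

IsHom : ∀ {n} → Vec Bool n → (G n → G n) → Set
IsHom es t = ∀ g g' → t (addG es g g') ≡ addG es (t g) (t g')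

IsGenIsometry : ∀ {n} → Vec F4 n → (G n → G n) → Set
IsGenIsometry as t = Σ Bool λ σ → ∀ g → Q as (t g) ≡ galois σ (Q as g)
  where open import Data.Product using (Σ)

module Submission where

open import Defs
open import Data.Bool using (Bool; true; false) renaming (_≟_ to _≟B_)
open import Data.Nat using (ℕ; _≤_; _<_; _*_; _^_)
open import Data.Nat.Properties using (*-monoʳ-≤; <-irrefl; ≤-<-trans)
open import Data.Vec using (Vec; []; _∷_)
open import Data.Vec.Properties using (∷-injective)
open import Data.List.Relation.Binary.Sublist.Propositional using (⊆-refl)
open import Data.List.Relation.Binary.Sublist.Propositional.Properties using (filter⁺; length-mono-≤)
open import Data.Product using (_,_)
open import Data.Product.Properties using (,-injective)
open import Function using (_∘_)
open import Function.Bundles using (_↔_; Inverse)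
open import Relation.Binary.PropositionalEquality using (_≡_; refl; sym; trans; cong; cong₂; subst; module ≡-Reasoning)
open import Relation.Nullary using (¬_)
open import Relation.Unary using (Pred; Decidable; _⊆_)
open import Level using (0ℓ)

-- If τ is a homomorphism and a translation R(k) commutes with R(h)∘τ, then evaluating both
-- composites at 0 gives h + k = τ(k) + h, so k is fixed by τ. Hence an abelian G_{K,τ,h}
-- forces K ⊆ Fix(τ), i.e. e·|Fix(τ)| ≥ e·|K| = |G_e|. Only the two index hypotheses and the
-- homomorphism property of τ enter.

⊕-identityʳ : ∀ a → a ⊕ 𝟎 ≡ a
⊕-identityʳ 𝟎 = refl
⊕-identityʳ 𝟏 = refl
⊕-identityʳ ω = refl
⊕-identityʳ ω+1 = refl

⊕-comm : ∀ a b → a ⊕ b ≡ b ⊕ a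
⊕-comm 𝟎 𝟎 = refl
⊕-comm 𝟎 𝟏 = refl
⊕-comm 𝟎 ω = refl
⊕-comm 𝟎 ω+1 = refl
⊕-comm 𝟏 𝟎 = refl
⊕-comm 𝟏 𝟏 = refl
⊕-comm 𝟏 ω = refl
⊕-comm 𝟏 ω+1 = refl
⊕-comm ω 𝟎 = refl
⊕-comm ω 𝟏 = refl
⊕-comm ω ω = refl
⊕-comm ω ω+1 = refl
⊕-comm ω+1 𝟎 = refl
⊕-comm ω+1 𝟏 = refl
⊕-comm ω+1 ω = refl
⊕-comm ω+1 ω+1 = refl

⊕-⊕-cancel : ∀ a c → a ⊕ c ⊕ c ≡ a
⊕-⊕-cancel 𝟎 𝟎 = refl
⊕-⊕-cancel 𝟎 𝟏 = refl
⊕-⊕-cancel 𝟎 ω = refl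
⊕-⊕-cancel 𝟎 ω+1 = refl
⊕-⊕-cancel 𝟏 𝟎 = refl
⊕-⊕-cancel 𝟏 𝟏 = refl
⊕-⊕-cancel 𝟏 ω = refl
⊕-⊕-cancel 𝟏 ω+1 = refl
⊕-⊕-cancel ω 𝟎 = refl
⊕-⊕-cancel ω 𝟏 = refl
⊕-⊕-cancel ω ω = refl
⊕-⊕-cancel ω ω+1 = refl
⊕-⊕-cancel ω+1 𝟎 = refl
⊕-⊕-cancel ω+1 𝟏 = refl
⊕-⊕-cancel ω+1 ω = refl
⊕-⊕-cancel ω+1 ω+1 = refl

⊕-cancelʳ : ∀ a b c → a ⊕ c ≡ b ⊕ c → a ≡ b
⊕-cancelʳ a b c eq = begin
  a         ≡⟨ sym (⊕-⊕-cancel a c) ⟩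
  a ⊕ c ⊕ c ≡⟨ cong (_⊕ c) eq ⟩
  b ⊕ c ⊕ c ≡⟨ ⊕-⊕-cancel b c ⟩
  b         ∎
  where open ≡-Reasoning

⊗-comm : ∀ a b → a ⊗ b ≡ b ⊗ a
⊗-comm 𝟎 𝟎 = refl
⊗-comm 𝟎 𝟏 = refl
⊗-comm 𝟎 ω = refl
⊗-comm 𝟎 ω+1 = refl
⊗-comm 𝟏 𝟎 = refl
⊗-comm 𝟏 𝟏 = refl
⊗-comm 𝟏 ω = refl
⊗-comm 𝟏 ω+1 = refl
⊗-comm ω 𝟎 = refl
⊗-comm ω 𝟏 = refl
⊗-comm ω ω = refl
⊗-comm ω ω+1 = refl
⊗-comm ω+1 𝟎 = refl
⊗-comm ω+1 𝟏 = refl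
⊗-comm ω+1 ω = refl
⊗-comm ω+1 ω+1 = refl

ι-⊗-zeroʳ : ∀ ε → ι ε ⊗ 𝟎 ≡ 𝟎
ι-⊗-zeroʳ false = refl
ι-⊗-zeroʳ true = refl

addG-identityˡ : ∀ {n} (es : Vec Bool n) (g : G n) → addG es zeroG g ≡ g
addG-identityˡ [] [] = refl
addG-identityˡ (ε ∷ es) ((x , y) ∷ g) =
  cong₂ (λ y′ g′ → (x , y′) ∷ g′)
        (trans (cong (y ⊕_) (ι-⊗-zeroʳ ε)) (⊕-identityʳ y))
        (addG-identityˡ es g)

addG-comm : ∀ {n} (es : Vec Bool n) (g g′ : G n) → addG es g g′ ≡ addG es g′ g
addG-comm [] [] [] = refl
addG-comm (ε ∷ es) ((x , y) ∷ g) ((x′ , y′) ∷ g′) =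
  cong₂ _∷_
    (cong₂ _,_ (⊕-comm x x′)
               (cong₂ (λ s p → s ⊕ ι ε ⊗ sq p) (⊕-comm y y′) (⊗-comm x x′)))
    (addG-comm es g g′)

addG-cancelʳ : ∀ {n} (es : Vec Bool n) (a b c : G n) → addG es a c ≡ addG es b c → a ≡ b
addG-cancelʳ [] [] [] [] _ = refl
addG-cancelʳ (ε ∷ es) ((xa , ya) ∷ a) ((xb , yb) ∷ b) ((xc , yc) ∷ c) eq
  with head , tail ← ∷-injective eq
  with xEq , yEq ← ,-injective head
  with refl ← ⊕-cancelʳ xa xb xc xEq
  = cong₂ _∷_ (cong (xa ,_) (⊕-cancelʳ ya yb yc (⊕-cancelʳ _ _ _ yEq)))
              (addG-cancelʳ es a b c tail)

IsHom⇒zero-preserving : ∀ {n} (es : Vec Bool n) {t : G n → G n} → IsHom es t → t zeroG ≡ zeroG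
IsHom⇒zero-preserving es {t} hom = sym (addG-cancelʳ es zeroG (t zeroG) (t zeroG) (begin
  addG es zeroG (t zeroG)        ≡⟨ addG-identityˡ es (t zeroG) ⟩
  t zeroG                        ≡⟨ cong t (sym (addG-identityˡ es zeroG)) ⟩
  t (addG es zeroG zeroG)        ≡⟨ hom zeroG zeroG ⟩
  addG es (t zeroG) (t zeroG)    ∎))
  where open ≡-Reasoning

commutes-with-affine⇒fixed : ∀ {n} (es : Vec Bool n) {t : G n → G n} → IsHom es t → (h k : G n)
  → (∀ x → R es k (R es h (t x)) ≡ R es h (t (R es k x)))
  → t k ≡ k
commutes-with-affine⇒fixed es {t} hom h k comm = addG-cancelʳ es (t k) k h (begin
  addG es (t k) h                    ≡⟨ cong (λ z → addG es (t z) h) (sym (addG-identityˡ es k)) ⟩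
  R es h (t (R es k zeroG))          ≡⟨ sym (comm zeroG) ⟩
  addG es (addG es (t zeroG) h) k    ≡⟨ cong (λ z → addG es (addG es z h) k) (IsHom⇒zero-preserving es hom) ⟩
  addG es (addG es zeroG h) k        ≡⟨ cong (λ z → addG es z k) (addG-identityˡ es h) ⟩
  addG es h k                        ≡⟨ addG-comm es h k ⟩
  addG es k h                        ∎)
  where open ≡-Reasoning

card-mono : ∀ {n} {P Q : Pred (G n) 0ℓ} (P? : Decidable P) (Q? : Decidable Q)
  → P ⊆ Q → card P P? ≤ card Q Q?
card-mono {n} P? Q? P⊆Q = length-mono-≤ (filter⁺ P? Q? (λ { refl → P⊆Q }) (⊆-refl {x = allG n}))

mainTheorem3 : (n : ℕ) → 2 ≤ n → (es : Vec Bool n) (as : Vec F4 n)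
    → (τ : G n ↔ G n)
    → IsHom es (Inverse.to τ)
    → IsGenIsometry as (Inverse.to τ)
    → (e : ℕ) → 1 < e
    → (∀ g → iter (Inverse.to τ) e g ≡ g)
    → (∀ k → 1 ≤ k → k < e → ¬ (∀ g → iter (Inverse.to τ) k g ≡ g))
    → (K : G n → Bool) → IsSubgroup es K
    → (∀ g → K g ≡ true → K (Inverse.to τ g) ≡ true)
    → 16 ^ n ≡ e * card (λ g → K g ≡ true) (λ g → K g ≟B true)
    → (h : G n)
    → K (hsum es (Inverse.to τ) h e) ≡ true
    → (∀ i → 1 ≤ i → i < e → K (hsum es (Inverse.to τ) h i) ≡ false)
    → e * card (λ g → Inverse.to τ g ≡ g) (λ g → Inverse.to τ g ≟G g) < 16 ^ n
    → ¬ (∀ f f' → InGen es K (Inverse.to τ) (Inverse.from τ) h f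
    → InGen es K (Inverse.to τ) (Inverse.from τ) h f'
    → ∀ x → f (f' x) ≡ f' (f x))
mainTheorem3 n _ es _ τ hom _ e _ _ _ K _ _ index h _ _ fix-small abelian =
  <-irrefl refl (≤-<-trans (subst (_≤ e * card Fix Fix?) (sym index) eK≤eFix) fix-small)
  where
  t = Inverse.to τ
  Fix : Pred (G n) 0ℓ
  Fix g = t g ≡ g
  Fix? : Decidable Fix
  Fix? g = t g ≟G g
  K⊆Fix : (λ g → K g ≡ true) ⊆ Fix
  K⊆Fix {k} k∈K = commutes-with-affine⇒fixed es hom h k
    (abelian (R es k) (R es h ∘ t) (gen-R k k∈K gen-id) (gen-Rτ gen-id))
  eK≤eFix : e * card (λ g → K g ≡ true) (λ g → K g ≟B true) ≤ e * card Fix Fix?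
  eK≤eFix = *-monoʳ-≤ e (card-mono (λ g → K g ≟B true) Fix? K⊆Fix)
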